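{- Let $s$ be a string of length $n$ over an alphabet of size $\sigma$ that has period $\ell$ (i.e., $s[i]=s[i+\ell]$ for all $1\le i\le n-\ell$). Then the smallest context-free grammar that generates $s$ and only $s$ has size $O(\ell\log\sigma+\log n\log\log n)$ bits.
   Context: A grammar for $s$ is a context-free grammar whose language is exactly $\{s\}$; its size is measured as the number of bits needed to write down all its productions. Logarithms are base 2. -}

module Defs where

open import Data.Nat using (ℕ; zero; suc; _+_; _*_)
open import Data.Nat.Logarithm using (⌈log₂_⌉)
open import Data.Fin using (Fin; toℕ)
open import Data.Sum using (_⊎_; inj₁; inj₂)
open import Data.Product using (_×_; _,_)
open import Data.List using (List; []; _∷_; _++_; [_])
open import Data.List.Membership.Propositional using (_∈_)
open import Data.Vec using (Vec; lookup)
open import Relation.Binary.PropositionalEquality using (_≡_)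

Symbol : ℕ → ℕ → Set
Symbol σ r = Fin σ ⊎ Fin r

record Grammar (σ : ℕ) : Set where
  field
    r     : ℕ
    start : Fin r
    rules : List (Fin r × List (Symbol σ r))
open Grammar public

mutual
  data Derives {σ : ℕ} (G : Grammar σ) : Symbol σ (r G) → List (Fin σ) → Set where
    term : ∀ a → Derives G (inj₁ a) [ a ]
    nonterm : ∀ {A rhs w} → (A , rhs) ∈ rules G → DerivesList G rhs w →
              Derives G (inj₂ A) w

  data DerivesList {σ : ℕ} (G : Grammar σ) : List (Symbol σ (r G)) → List (Fin σ) → Set where
    nil  : DerivesList G [] []
    cons : ∀ {x xs u v} → Derives G x u → DerivesList G xs v →
           DerivesList G (x ∷ xs) (u ++ v)

GeneratesExactly : ∀ {σ} → Grammar σ → List (Fin σ) → Set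
GeneratesExactly G w =
  Derives G (inj₂ (start G)) w × (∀ u → Derives G (inj₂ (start G)) u → u ≡ w)

-- Encoding: each production is
-- written as its left-hand side (⌈log₂ r⌉ bits), then its right-hand side
-- symbols, then an end marker; every rhs symbol carries a 2-bit tag
-- (terminal / nonterminal / end) followed by its index: ⌈log₂ σ⌉ bits for a
-- terminal, ⌈log₂ r⌉ bits for a nonterminal.
symbolBits : ∀ {σ r} → Symbol σ r → ℕ
symbolBits {σ} {r} (inj₁ _) = 2 + ⌈log₂ σ ⌉
symbolBits {σ} {r} (inj₂ _) = 2 + ⌈log₂ r ⌉

rhsBits : ∀ {σ r} → List (Symbol σ r) → ℕ
rhsBits [] = 2
rhsBits (x ∷ xs) = symbolBits x + rhsBits xs

rulesBits : ∀ {σ r} → List (Fin r × List (Symbol σ r)) → ℕ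
rulesBits [] = 0
rulesBits {σ} {r} ((_ , rhs) ∷ rs) = ⌈log₂ r ⌉ + rhsBits rhs + rulesBits rs

size : ∀ {σ} → Grammar σ → ℕ
size G = rulesBits (rules G)

HasPeriod : ∀ {σ n} → Vec (Fin σ) n → ℕ → Set
HasPeriod {σ} {n} s ℓ = ∀ (i j : Fin n) → toℕ j ≡ toℕ i + ℓ → lookup s i ≡ lookup s j

-- A string with period ℓ factors as u ^ k · r with |u|, |r| ≤ ℓ and k ≤ n.  With the
-- binary digits b₀ b₁ … bₘ₋₁ of k (least significant first) the grammar
--   S → Q₀ r,   U → u,   Qᵢ → Qᵢ₊₁ Qᵢ₊₁ [U if bᵢ = 1],   Qₘ → ε
-- derives s and nothing else: giving Qᵢ the meaning u ^ (Σ_{j ≥ i} bⱼ 2^(j−i)), every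
-- rule respects the meanings, so every derivation yields them.  It has m = O(log n)
-- rules of O(log m) = O(log log n) bits, plus |u| + |r| ≤ 2ℓ terminals of O(log σ) bits.
module Submission where

open import Defs
open import Data.Bool using (Bool; true; false)
open import Data.Fin as Fin using (Fin; toℕ; fromℕ<)
open import Data.Fin.Properties using (toℕ-fromℕ<)
open import Data.List using (List; []; _∷_; _++_; length; map; concatMap; take; drop)
open import Data.List.Properties
  using (++-assoc; ++-cancelˡ; length-++; length-take; length-drop; take++drop≡id; ∷-injectiveˡ; ∷-injectiveʳ)
open import Data.List.Membership.Propositional using (_∈_)
open import Data.List.Relation.Binary.Subset.Propositional using (_⊆_)
open import Data.List.Relation.Unary.Any using (here; there)
open import Data.Maybe using (Maybe; just; nothing)
open import Data.Nat using (ℕ; zero; suc; _+_; _*_; _^_; _≤_; _<_; _≤?_; z≤n; s≤s; ⌊_/2⌋; ⌈_/2⌉)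
open import Data.Nat.Induction using (<-wellFounded)
open import Data.Nat.Logarithm using (⌈log₂_⌉; ⌈log₂⌉-mono-≤; ⌈log₂2*n⌉≡1+⌈log₂n⌉)
open import Data.Nat.Logarithm.Core using (⌈log2⌉)
open import Data.Nat.Properties
open import Data.Nat.Tactic.RingSolver using (solve-∀)
open import Data.Product using (Σ; ∃; ∃₂; _×_; _,_)
open import Data.Sum using (inj₁; inj₂)
open import Data.Vec using (Vec; toList; lookup)
import Data.Vec as Vec
open import Data.Vec.Properties using (length-toList)
open import Induction.WellFounded using (Acc; acc)
open import Relation.Binary.PropositionalEquality using (_≡_; refl; sym; trans; cong; cong₂; subst; module ≡-Reasoning)
open import Relation.Nullary using (yes; no)

private
  variable
    A : Set
    σ n : ℕ

_^^_ : List A → ℕ → List A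
u ^^ zero  = []
u ^^ suc k = u ++ u ^^ k

^^-+ : ∀ (u : List A) k l → u ^^ (k + l) ≡ u ^^ k ++ u ^^ l
^^-+ u zero    l = refl
^^-+ u (suc k) l = trans (cong (u ++_) (^^-+ u k l)) (sym (++-assoc u (u ^^ k) (u ^^ l)))

bit : Bool → ℕ
bit false = 0
bit true  = 1

fromBits : List Bool → ℕ
fromBits []       = 0
fromBits (b ∷ bs) = fromBits bs + fromBits bs + bit b

lowBit : ℕ → Bool
lowBit 0             = false
lowBit 1             = true
lowBit (suc (suc k)) = lowBit k

⌊k/2⌋+⌊k/2⌋+lowBit≡k : ∀ k → ⌊ k /2⌋ + ⌊ k /2⌋ + bit (lowBit k) ≡ k
⌊k/2⌋+⌊k/2⌋+lowBit≡k 0             = refl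
⌊k/2⌋+⌊k/2⌋+lowBit≡k 1             = refl
⌊k/2⌋+⌊k/2⌋+lowBit≡k (suc (suc k)) =
  cong suc (trans (cong (_+ bit (lowBit k)) (+-suc ⌊ k /2⌋ ⌊ k /2⌋)) (cong suc (⌊k/2⌋+⌊k/2⌋+lowBit≡k k)))

toBits : ℕ → ℕ → List Bool
toBits zero    k = []
toBits (suc f) k = lowBit k ∷ toBits f ⌊ k /2⌋

length-toBits : ∀ f k → length (toBits f k) ≡ f
length-toBits zero    k = refl
length-toBits (suc f) k = cong suc (length-toBits f ⌊ k /2⌋)

⌊k/2⌋<p : ∀ k p → k < p + p → ⌊ k /2⌋ < p
⌊k/2⌋<p k p k<p+p = ≰⇒> λ p≤⌊k/2⌋ → n≮n k (<-≤-trans k<p+p (begin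
    p + p                               ≤⟨ +-mono-≤ p≤⌊k/2⌋ p≤⌊k/2⌋ ⟩
    ⌊ k /2⌋ + ⌊ k /2⌋                   ≤⟨ m≤m+n _ (bit (lowBit k)) ⟩
    ⌊ k /2⌋ + ⌊ k /2⌋ + bit (lowBit k)  ≡⟨ ⌊k/2⌋+⌊k/2⌋+lowBit≡k k ⟩
    k                                   ∎))
  where open ≤-Reasoning

fromBits-toBits : ∀ f k → k < 2 ^ f → fromBits (toBits f k) ≡ k
fromBits-toBits zero    zero    _         = refl
fromBits-toBits zero    (suc k) (s≤s ())
fromBits-toBits (suc f) k k<2^[1+f] = trans
  (cong (λ h → h + h + bit (lowBit k))
        (fromBits-toBits f ⌊ k /2⌋ (⌊k/2⌋<p k (2 ^ f) (subst (k <_) (cong (2 ^ f +_) (+-identityʳ (2 ^ f))) k<2^[1+f]))))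
  (⌊k/2⌋+⌊k/2⌋+lowBit≡k k)

-- Periodic strings are powers

at : List A → ℕ → Maybe A
at []       _       = nothing
at (x ∷ xs) zero    = just x
at (x ∷ xs) (suc i) = at xs i

at-toList : ∀ (s : Vec A n) (i : Fin n) → at (toList s) (toℕ i) ≡ just (lookup s i)
at-toList (x Vec.∷ s) Fin.zero    = refl
at-toList (x Vec.∷ s) (Fin.suc i) = at-toList s i

at-drop : ∀ k (xs : List A) i → at (drop k xs) i ≡ at xs (k + i)
at-drop zero    xs       i = refl
at-drop (suc k) []       i = refl
at-drop (suc k) (x ∷ xs) i = at-drop k xs i

prefix-by-at : ∀ (xs ys : List A) → length xs ≤ length ys →
               (∀ i → i < length xs → at xs i ≡ at ys i) → ∃ λ zs → ys ≡ xs ++ zs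
prefix-by-at []       ys       _         _    = ys , refl
prefix-by-at (x ∷ xs) (y ∷ ys) (s≤s len≤) agree
  with prefix-by-at xs ys len≤ (λ i i< → agree (suc i) (s≤s i<))
... | zs , ys≡ with agree 0 (s≤s z≤n)
...   | refl = zs , cong (x ∷_) ys≡

++-≡⇒prefix : ∀ (a b c d : List A) → a ++ b ≡ c ++ d → length a ≤ length c → ∃ λ e → c ≡ a ++ e
++-≡⇒prefix []      b c       d _  _          = c , refl
++-≡⇒prefix (x ∷ a) b (y ∷ c) d eq (s≤s len≤) with ++-≡⇒prefix a b c d (∷-injectiveʳ eq) len≤
... | e , c≡ = e , cong₂ _∷_ (sym (∷-injectiveˡ eq)) c≡

HasPeriod⇒at : ∀ {ℓ} (s : Vec (Fin σ) n) → HasPeriod s ℓ →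
               ∀ i → i + ℓ < length (toList s) → at (toList s) i ≡ at (toList s) (i + ℓ)
HasPeriod⇒at {n = n} {ℓ} s per i i+ℓ<len = begin
    at (toList s) i          ≡⟨ cong (at (toList s)) (sym (toℕ-fromℕ< i<n)) ⟩
    at (toList s) (toℕ I)    ≡⟨ at-toList s I ⟩
    just (lookup s I)        ≡⟨ cong just (per I J toℕJ≡toℕI+ℓ) ⟩
    just (lookup s J)        ≡⟨ at-toList s J ⟨
    at (toList s) (toℕ J)    ≡⟨ cong (at (toList s)) (toℕ-fromℕ< i+ℓ<n) ⟩
    at (toList s) (i + ℓ)    ∎
  where
  open ≡-Reasoning
  i+ℓ<n : i + ℓ < n
  i+ℓ<n = <-≤-trans i+ℓ<len (≤-reflexive (length-toList s))
  i<n : i < n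
  i<n = ≤-<-trans (m≤m+n i ℓ) i+ℓ<n
  I J : Fin n
  I = fromℕ< i<n
  J = fromℕ< i+ℓ<n
  toℕJ≡toℕI+ℓ : toℕ J ≡ toℕ I + ℓ
  toℕJ≡toℕI+ℓ = trans (toℕ-fromℕ< i+ℓ<n) (cong (_+ ℓ) (sym (toℕ-fromℕ< i<n)))

u++L≡L++t⇒power : ∀ (u t L : List A) → 1 ≤ length u → Acc _<_ (length L) → u ++ L ≡ L ++ t →
                  ∃₂ λ k r → L ≡ u ^^ k ++ r × length r < length u × k ≤ length L
u++L≡L++t⇒power u t L 1≤|u| (acc rec) eq with length u ≤? length L
... | no  u≰L = 0 , L , refl , ≰⇒> u≰L , z≤n
... | yes u≤L with ++-≡⇒prefix u L L t eq u≤L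
...   | L′ , refl with u++L≡L++t⇒power u t L′ 1≤|u| (rec |L′|<|u++L′|) eq′
  where
  |L′|<|u++L′| : length L′ < length (u ++ L′)
  |L′|<|u++L′| = <-≤-trans (n<1+n (length L′)) (≤-trans (+-monoˡ-≤ (length L′) 1≤|u|) (≤-reflexive (sym (length-++ u))))
  eq′ : u ++ L′ ≡ L′ ++ t
  eq′ = ++-cancelˡ u _ _ (trans eq (++-assoc u L′ t))
...   | k , r , L′≡ , |r|<|u| , k≤|L′| =
  suc k , r , trans (cong (u ++_) L′≡) (sym (++-assoc u (u ^^ k) r)) , |r|<|u| ,
  ≤-trans (s≤s k≤|L′|) (≤-trans (+-monoˡ-≤ (length L′) 1≤|u|) (≤-reflexive (sym (length-++ u))))

record PowerSplit (ℓ : ℕ) (w : List A) : Set where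
  field
    root              : List A
    exponent          : ℕ
    remainder         : List A
    w≡                : w ≡ root ^^ exponent ++ remainder
    length-root≤      : length root ≤ ℓ
    length-remainder≤ : length remainder ≤ ℓ
    exponent≤         : exponent ≤ length w

HasPeriod⇒shift : ∀ {ℓ} (s : Vec (Fin σ) n) → HasPeriod s ℓ → ℓ ≤ length (toList s) →
                  ∃ λ t → take ℓ (toList s) ++ toList s ≡ toList s ++ t
HasPeriod⇒shift {ℓ = ℓ} s per ℓ≤L
  with prefix-by-at (drop ℓ L) L (≤-trans (≤-reflexive (length-drop ℓ L)) (m∸n≤m (length L) ℓ)) shifted
  where
  L = toList s
  shifted : ∀ i → i < length (drop ℓ L) → at (drop ℓ L) i ≡ at L i
  shifted i i<|drop| = begin
      at (drop ℓ L) i  ≡⟨ at-drop ℓ L i ⟩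
      at L (ℓ + i)     ≡⟨ cong (at L) (+-comm ℓ i) ⟩
      at L (i + ℓ)     ≡⟨ HasPeriod⇒at s per i i+ℓ<L ⟨
      at L i           ∎
    where
    open ≡-Reasoning
    i+ℓ<L : i + ℓ < length L
    i+ℓ<L = <-≤-trans (+-monoˡ-< ℓ (<-≤-trans i<|drop| (≤-reflexive (length-drop ℓ L)))) (≤-reflexive (m∸n+n≡m ℓ≤L))
... | t , L≡ = t , (begin
    take ℓ L ++ L                   ≡⟨ cong (take ℓ L ++_) L≡ ⟩
    take ℓ L ++ (drop ℓ L ++ t)     ≡⟨ ++-assoc (take ℓ L) (drop ℓ L) t ⟨
    (take ℓ L ++ drop ℓ L) ++ t     ≡⟨ cong (_++ t) (take++drop≡id ℓ L) ⟩
    L ++ t                          ∎)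
  where
  open ≡-Reasoning
  L = toList s

periodic⇒PowerSplit : ∀ {ℓ} (s : Vec (Fin σ) n) → 1 ≤ ℓ → HasPeriod s ℓ → PowerSplit ℓ (toList s)
periodic⇒PowerSplit {ℓ = ℓ} s 1≤ℓ per with ℓ ≤? length (toList s)
... | no ℓ≰L = record
  { root = [] ; exponent = 0 ; remainder = toList s ; w≡ = refl
  ; length-root≤ = z≤n ; length-remainder≤ = <⇒≤ (≰⇒> ℓ≰L) ; exponent≤ = z≤n }
... | yes ℓ≤L with HasPeriod⇒shift s per ℓ≤L
...   | t , shift with u++L≡L++t⇒power (take ℓ (toList s)) t (toList s) 1≤|u| (<-wellFounded _) shift
  where
  1≤|u| : 1 ≤ length (take ℓ (toList s))
  1≤|u| = subst (1 ≤_) (sym (trans (length-take ℓ (toList s)) (m≤n⇒m⊓n≡m ℓ≤L))) 1≤ℓ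
...   | k , r , L≡u^kr , |r|<|u| , k≤L = record
  { root = take ℓ (toList s) ; exponent = k ; remainder = r ; w≡ = L≡u^kr
  ; length-root≤ = |u|≤ℓ ; length-remainder≤ = <⇒≤ (<-≤-trans |r|<|u| |u|≤ℓ) ; exponent≤ = k≤L }
  where
  |u|≤ℓ : length (take ℓ (toList s)) ≤ ℓ
  |u|≤ℓ = ≤-trans (≤-reflexive (length-take ℓ (toList s))) (m⊓n≤m ℓ _)

-- Grammars with a sound interpretation

module Interpretation {σ : ℕ} (G : Grammar σ) (⟦_⟧ : Fin (r G) → List (Fin σ)) where

  ⟦_⟧ˢ : Symbol σ (r G) → List (Fin σ)
  ⟦ inj₁ a ⟧ˢ = a ∷ []
  ⟦ inj₂ A ⟧ˢ = ⟦ A ⟧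

  ⟦_⟧* : List (Symbol σ (r G)) → List (Fin σ)
  ⟦_⟧* = concatMap ⟦_⟧ˢ

  Sound : Set
  Sound = ∀ {A rhs} → (A , rhs) ∈ rules G → ⟦ rhs ⟧* ≡ ⟦ A ⟧

  module _ (sound : Sound) where

    mutual
      Derives⇒≡⟦⟧ : ∀ {x w} → Derives G x w → w ≡ ⟦ x ⟧ˢ
      Derives⇒≡⟦⟧ (term a)           = refl
      Derives⇒≡⟦⟧ (nonterm A→rhs ds) = trans (DerivesList⇒≡⟦⟧ ds) (sound A→rhs)

      DerivesList⇒≡⟦⟧ : ∀ {xs w} → DerivesList G xs w → w ≡ ⟦ xs ⟧*
      DerivesList⇒≡⟦⟧ nil         = refl
      DerivesList⇒≡⟦⟧ (cons d ds) = cong₂ _++_ (Derives⇒≡⟦⟧ d) (DerivesList⇒≡⟦⟧ ds)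

    generatesExactly : Derives G (inj₂ (start G)) ⟦ start G ⟧ → GeneratesExactly G ⟦ start G ⟧
    generatesExactly d = d , λ w d′ → Derives⇒≡⟦⟧ d′

-- The grammar of u ^ (fromBits bs) · v

-- Out-of-range indices are clamped, so nonterminals can be named without bound proofs.
clamp : (R x : ℕ) → Fin (suc R)
clamp R       zero    = Fin.zero
clamp zero    (suc x) = Fin.zero
clamp (suc R) (suc x) = Fin.suc (clamp R x)

drop-clamp : ∀ i (xs : List A) → drop (toℕ (clamp (length xs) i)) xs ≡ drop i xs
drop-clamp zero    xs       = refl
drop-clamp (suc i) []       = refl
drop-clamp (suc i) (x ∷ xs) = drop-clamp i xs

drop-suc : ∀ i (xs : List A) {b bs} → drop i xs ≡ b ∷ bs → drop (suc i) xs ≡ bs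
drop-suc zero    (x ∷ xs) refl = refl
drop-suc (suc i) (x ∷ xs) eq   = drop-suc i xs eq

^^-fromBits-∷ : ∀ (u : List A) b bs →
                u ^^ fromBits (b ∷ bs) ≡ u ^^ fromBits bs ++ (u ^^ fromBits bs ++ u ^^ bit b)
^^-fromBits-∷ u b bs = begin
    u ^^ (fromBits bs + fromBits bs + bit b)               ≡⟨ ^^-+ u (fromBits bs + fromBits bs) (bit b) ⟩
    u ^^ (fromBits bs + fromBits bs) ++ u ^^ bit b         ≡⟨ cong (_++ u ^^ bit b) (^^-+ u (fromBits bs) (fromBits bs)) ⟩
    (u ^^ fromBits bs ++ u ^^ fromBits bs) ++ u ^^ bit b   ≡⟨ ++-assoc (u ^^ fromBits bs) _ _ ⟩
    u ^^ fromBits bs ++ (u ^^ fromBits bs ++ u ^^ bit b)   ∎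
  where open ≡-Reasoning

module PowerGrammar {σ : ℕ} (u v : List (Fin σ)) (bs : List Bool) where

  m : ℕ
  m = length bs

  NT : Set
  NT = Fin (3 + m)

  Sym : Set
  Sym = Symbol σ (3 + m)

  S U : NT
  S = clamp (2 + m) 0
  U = clamp (2 + m) 1

  Q : ℕ → NT
  Q i = clamp (2 + m) (2 + i)

  terminals : List (Fin σ) → List Sym
  terminals = map inj₁

  optionalU : Bool → List Sym
  optionalU false = []
  optionalU true  = inj₂ U ∷ []

  chainRules : ℕ → List Bool → List (NT × List Sym)
  chainRules i []        = (Q i , []) ∷ []
  chainRules i (b ∷ bs′) = (Q i , inj₂ (Q (suc i)) ∷ inj₂ (Q (suc i)) ∷ optionalU b) ∷ chainRules (suc i) bs′

  G : Grammar σ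
  G = record
    { r     = 3 + m
    ; start = S
    ; rules = (S , inj₂ (Q 0) ∷ terminals v) ∷ (U , terminals u) ∷ chainRules 0 bs }

  meaning : ℕ → List (Fin σ)
  meaning 0             = u ^^ fromBits bs ++ v
  meaning 1             = u
  meaning (suc (suc i)) = u ^^ fromBits (drop i bs)

  ⟦_⟧ : NT → List (Fin σ)
  ⟦ A ⟧ = meaning (toℕ A)

  open Interpretation G ⟦_⟧

  ⟦Q⟧ : ∀ i → ⟦ Q i ⟧ ≡ u ^^ fromBits (drop i bs)
  ⟦Q⟧ i = cong (λ bs′ → u ^^ fromBits bs′) (drop-clamp i bs)

  ⟦terminals⟧ : ∀ w → ⟦ terminals w ⟧* ≡ w
  ⟦terminals⟧ []      = refl
  ⟦terminals⟧ (a ∷ w) = cong (a ∷_) (⟦terminals⟧ w)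

  ⟦optionalU⟧ : ∀ b → ⟦ optionalU b ⟧* ≡ u ^^ bit b
  ⟦optionalU⟧ false = refl
  ⟦optionalU⟧ true  = refl

  chainRules-sound : ∀ i bs′ → drop i bs ≡ bs′ →
                     ∀ {A rhs} → (A , rhs) ∈ chainRules i bs′ → ⟦ rhs ⟧* ≡ ⟦ A ⟧
  chainRules-sound i []        drop≡ (here refl) = sym (trans (⟦Q⟧ i) (cong (λ bs′ → u ^^ fromBits bs′) drop≡))
  chainRules-sound i (b ∷ bs′) drop≡ (here refl) = begin
      ⟦ Q (suc i) ⟧ ++ (⟦ Q (suc i) ⟧ ++ ⟦ optionalU b ⟧*)
    ≡⟨ cong₂ (λ x y → x ++ (x ++ y)) ⟦Q[1+i]⟧ (⟦optionalU⟧ b) ⟩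
      u ^^ fromBits bs′ ++ (u ^^ fromBits bs′ ++ u ^^ bit b)
    ≡⟨ ^^-fromBits-∷ u b bs′ ⟨
      u ^^ fromBits (b ∷ bs′)
    ≡⟨ trans (⟦Q⟧ i) (cong (λ bs″ → u ^^ fromBits bs″) drop≡) ⟨
      ⟦ Q i ⟧
    ∎
    where
    open ≡-Reasoning
    ⟦Q[1+i]⟧ : ⟦ Q (suc i) ⟧ ≡ u ^^ fromBits bs′
    ⟦Q[1+i]⟧ = trans (⟦Q⟧ (suc i)) (cong (λ bs″ → u ^^ fromBits bs″) (drop-suc i bs drop≡))
  chainRules-sound i (b ∷ bs′) drop≡ (there r∈) = chainRules-sound (suc i) bs′ (drop-suc i bs drop≡) r∈

  sound : Sound
  sound (here refl)         = cong₂ _++_ (⟦Q⟧ 0) (⟦terminals⟧ v)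
  sound (there (here refl)) = ⟦terminals⟧ u
  sound (there (there r∈))  = chainRules-sound 0 bs refl r∈

  derives-terminals : ∀ w → DerivesList G (terminals w) w
  derives-terminals []      = nil
  derives-terminals (a ∷ w) = cons (term a) (derives-terminals w)

  derives-optionalU : ∀ b → DerivesList G (optionalU b) (u ^^ bit b)
  derives-optionalU false = nil
  derives-optionalU true  = cons (nonterm (there (here refl)) (derives-terminals u)) nil

  derives-Q : ∀ i bs′ → chainRules i bs′ ⊆ rules G → Derives G (inj₂ (Q i)) (u ^^ fromBits bs′)
  derives-Q i []        ⊆G = nonterm (⊆G (here refl)) nil
  derives-Q i (b ∷ bs′) ⊆G = subst (Derives G (inj₂ (Q i))) (sym (^^-fromBits-∷ u b bs′))
    (nonterm (⊆G (here refl)) (cons half (cons half (derives-optionalU b))))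
    where
    half : Derives G (inj₂ (Q (suc i))) (u ^^ fromBits bs′)
    half = derives-Q (suc i) bs′ (λ r∈ → ⊆G (there r∈))

  generates : GeneratesExactly G (u ^^ fromBits bs ++ v)
  generates = generatesExactly sound
    (nonterm (here refl) (cons (derives-Q 0 bs (λ r∈ → there (there r∈))) (derives-terminals v)))

  width c : ℕ
  width = ⌈log₂ (3 + m) ⌉
  c     = 2 + ⌈log₂ σ ⌉

  rhsBits-terminals : ∀ w → rhsBits (terminals w) ≡ length w * c + 2
  rhsBits-terminals []      = refl
  rhsBits-terminals (a ∷ w) = trans (cong (c +_) (rhsBits-terminals w)) (sym (+-assoc c (length w * c) 2))

  rhsBits-optionalU : ∀ b → rhsBits (optionalU b) ≤ 4 + width
  rhsBits-optionalU false = s≤s (s≤s z≤n)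
  rhsBits-optionalU true  = ≤-reflexive (+-comm (2 + width) 2)

  rulesBits-chainRules : ∀ i bs′ → rulesBits (chainRules i bs′) ≤ suc (length bs′) * (4 * width + 8)
  rulesBits-chainRules i [] = begin
      width + 2 + 0                  ≡⟨ +-identityʳ (width + 2) ⟩
      width + 2                      ≤⟨ +-mono-≤ (m≤n*m width 4) (m≤m+n 2 6) ⟩
      4 * width + 8                  ≡⟨ +-identityʳ (4 * width + 8) ⟨
      1 * (4 * width + 8)            ∎
    where open ≤-Reasoning
  rulesBits-chainRules i (b ∷ bs′) = +-mono-≤ rule≤ (rulesBits-chainRules (suc i) bs′)
    where
    rule≤ : width + (2 + width + (2 + width + rhsBits (optionalU b))) ≤ 4 * width + 8
    rule≤ = ≤-trans (+-monoʳ-≤ width (+-monoʳ-≤ (2 + width) (+-monoʳ-≤ (2 + width) (rhsBits-optionalU b))))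
                    (≤-reflexive (regroup width))
      where
      regroup : ∀ x → x + (2 + x + (2 + x + (4 + x))) ≡ 4 * x + 8
      regroup = solve-∀

  size-bound : size G ≤ (3 + m) * (4 * width + 8) + (length u + length v) * c
  size-bound = begin
      width + (2 + width + rhsBits (terminals v)) + (width + rhsBits (terminals u) + rulesBits (chainRules 0 bs))
    ≡⟨ cong₂ (λ x y → width + (2 + width + x) + (width + y + rulesBits (chainRules 0 bs))) (rhsBits-terminals v) (rhsBits-terminals u) ⟩
      width + (2 + width + (length v * c + 2)) + (width + (length u * c + 2) + rulesBits (chainRules 0 bs))
    ≤⟨ +-monoʳ-≤ (width + (2 + width + (length v * c + 2))) (+-monoʳ-≤ (width + (length u * c + 2)) (rulesBits-chainRules 0 bs)) ⟩
      width + (2 + width + (length v * c + 2)) + (width + (length u * c + 2) + suc m * (4 * width + 8))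
    ≤⟨ m≤m+n _ (5 * width + 10) ⟩
      width + (2 + width + (length v * c + 2)) + (width + (length u * c + 2) + suc m * (4 * width + 8)) + (5 * width + 10)
    ≡⟨ regroup width (length v) (length u) c m ⟩
      (3 + m) * (4 * width + 8) + (length u + length v) * c
    ∎
    where
    open ≤-Reasoning
    regroup : ∀ x a b y k → x + (2 + x + (a * y + 2)) + (x + (b * y + 2) + suc k * (4 * x + 8)) + (5 * x + 10)
                          ≡ (3 + k) * (4 * x + 8) + (b + a) * y
    regroup = solve-∀

n≤2^⌈log2⌉ : ∀ n (rs : Acc _<_ n) → n ≤ 2 ^ ⌈log2⌉ n rs
n≤2^⌈log2⌉ 0             _        = z≤n
n≤2^⌈log2⌉ 1             _        = s≤s z≤n
n≤2^⌈log2⌉ (suc (suc n)) (acc rs) = begin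
    2 + n                  ≤⟨ s≤s (s≤s n≤⌈n/2⌉+⌈n/2⌉) ⟩
    2 + (h + h)            ≡⟨ double-suc h ⟩
    2 * suc h              ≤⟨ *-monoʳ-≤ 2 (n≤2^⌈log2⌉ (suc h) _) ⟩
    2 * 2 ^ ⌈log2⌉ (suc h) _ ∎
  where
  open ≤-Reasoning
  h = ⌈ n /2⌉
  n≤⌈n/2⌉+⌈n/2⌉ : n ≤ h + h
  n≤⌈n/2⌉+⌈n/2⌉ = subst (_≤ h + h) (⌊n/2⌋+⌈n/2⌉≡n n) (+-monoˡ-≤ h (⌊n/2⌋≤⌈n/2⌉ n))
  double-suc : ∀ x → 2 + (x + x) ≡ 2 * suc x
  double-suc = solve-∀

n<2^[1+⌈log₂n⌉] : ∀ n → n < 2 ^ suc ⌈log₂ n ⌉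
n<2^[1+⌈log₂n⌉] n = ≤-<-trans (n≤2^⌈log2⌉ n (<-wellFounded n))
  (subst (2 ^ a <_) (cong (2 ^ a +_) (sym (+-identityʳ (2 ^ a)))) (m<m+n (2 ^ a) (m^n>0 2 a)))
  where a = ⌈log₂ n ⌉

loglog-bound : ∀ a → (4 + a) * (4 * ⌈log₂ (4 + a) ⌉ + 8) ≤ 100 * (a * ⌈log₂ a ⌉ + 1)
loglog-bound 0               = m≤m+n 64 36
loglog-bound 1               = ≤-refl
loglog-bound a@(suc (suc b)) = begin
    (4 + a) * (4 * ⌈log₂ (4 + a) ⌉ + 8)  ≤⟨ *-mono-≤ 4+a≤3a (+-monoˡ-≤ 8 (*-monoʳ-≤ 4 log[4+a]≤2+x)) ⟩
    (3 * a) * (4 * (2 + x) + 8)          ≤⟨ *-monoʳ-≤ (3 * a) (≤-trans (≤-reflexive (expand x))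
                                                                       (+-monoʳ-≤ (4 * x) (*-monoʳ-≤ 16 1≤x))) ⟩
    (3 * a) * (4 * x + 16 * x)           ≡⟨ collect a x ⟩
    60 * (a * x)                         ≤⟨ *-monoˡ-≤ (a * x) (m≤m+n 60 40) ⟩
    100 * (a * x)                        ≤⟨ *-monoʳ-≤ 100 (m≤m+n (a * x) 1) ⟩
    100 * (a * x + 1)                    ∎
  where
  open ≤-Reasoning
  x = ⌈log₂ a ⌉
  1≤x : 1 ≤ x
  1≤x = ⌈log₂⌉-mono-≤ {2} {a} (s≤s (s≤s z≤n))
  4+a≤3a : 4 + a ≤ 3 * a
  4+a≤3a = subst (4 + a ≤_) (3a-split b) (m≤m+n (4 + a) (b + b))
    where
    3a-split : ∀ b → 4 + (2 + b) + (b + b) ≡ 3 * (2 + b)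
    3a-split = solve-∀
  log[4+a]≤2+x : ⌈log₂ (4 + a) ⌉ ≤ 2 + x
  log[4+a]≤2+x = ≤-trans (⌈log₂⌉-mono-≤ 4+a≤4a) (≤-reflexive (trans (⌈log₂2*n⌉≡1+⌈log₂n⌉ (2 * a)) (cong suc (⌈log₂2*n⌉≡1+⌈log₂n⌉ a))))
    where
    4+a≤4a : 4 + a ≤ 2 * (2 * a)
    4+a≤4a = subst (4 + a ≤_) (4a-split b) (m≤m+n (4 + a) (b + b + b + 2))
      where
      4a-split : ∀ b → 4 + (2 + b) + (b + b + b + 2) ≡ 2 * (2 * (2 + b))
      4a-split = solve-∀
  expand : ∀ x → 4 * (2 + x) + 8 ≡ 4 * x + 16
  expand = solve-∀
  collect : ∀ a x → (3 * a) * (4 * x + 16 * x) ≡ 60 * (a * x)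
  collect = solve-∀

Fin≤1-allEqual : σ ≤ 1 → (x y : Fin σ) → x ≡ y
Fin≤1-allEqual {suc zero}    _        Fin.zero Fin.zero = refl
Fin≤1-allEqual {suc (suc _)} (s≤s ()) _        _

-- Over an alphabet of at most one letter ⌈log₂ σ⌉ = 0 and ℓ log σ vanishes,
-- so the period has to be traded for 1.
effective-period : ∀ ℓ (s : Vec (Fin σ) n) → 1 ≤ ℓ → HasPeriod s ℓ →
                   Σ ℕ λ ℓ′ → 1 ≤ ℓ′ × HasPeriod s ℓ′ × ℓ′ * (2 + ⌈log₂ σ ⌉) ≤ 3 * (ℓ * ⌈log₂ σ ⌉) + 2
effective-period {σ} ℓ s 1≤ℓ per with σ ≤? 1
... | yes σ≤1 = 1 , ≤-refl , (λ i j _ → Fin≤1-allEqual σ≤1 _ _) ,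
  subst (λ x → 1 * (2 + x) ≤ 3 * (ℓ * x) + 2) (sym (n≤0⇒n≡0 (⌈log₂⌉-mono-≤ σ≤1))) (m≤n+m 2 _)
... | no σ≰1 = ℓ , 1≤ℓ , per , (begin
    ℓ * (2 + x)        ≤⟨ *-monoʳ-≤ ℓ (+-monoˡ-≤ x (+-mono-≤ 1≤x 1≤x)) ⟩
    ℓ * (x + x + x)    ≡⟨ triple ℓ x ⟩
    3 * (ℓ * x)        ≤⟨ m≤m+n _ 2 ⟩
    3 * (ℓ * x) + 2    ∎)
  where
  open ≤-Reasoning
  x = ⌈log₂ σ ⌉
  1≤x : 1 ≤ x
  1≤x = ⌈log₂⌉-mono-≤ (≰⇒> σ≰1)
  triple : ∀ ℓ x → ℓ * (x + x + x) ≡ 3 * (ℓ * x)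
  triple = solve-∀

periodic-grammar : ∀ {ℓ} (s : Vec (Fin σ) n) → 1 ≤ ℓ → HasPeriod s ℓ →
  Σ (Grammar σ) λ G → GeneratesExactly G (toList s) ×
    size G ≤ (4 + ⌈log₂ n ⌉) * (4 * ⌈log₂ (4 + ⌈log₂ n ⌉) ⌉ + 8) + (ℓ + ℓ) * (2 + ⌈log₂ σ ⌉)
periodic-grammar {σ} {n} {ℓ} s 1≤ℓ per = G , generates′ , size≤
  where
  open PowerSplit (periodic⇒PowerSplit s 1≤ℓ per)
  a = ⌈log₂ n ⌉
  bs = toBits (suc a) exponent
  open PowerGrammar root remainder bs
  exponent<2^[1+a] : exponent < 2 ^ suc a
  exponent<2^[1+a] = ≤-<-trans (≤-trans exponent≤ (≤-reflexive (length-toList s))) (n<2^[1+⌈log₂n⌉] n)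
  generates′ : GeneratesExactly G (toList s)
  generates′ = subst (GeneratesExactly G)
    (sym (trans w≡ (cong (λ k → root ^^ k ++ remainder) (sym (fromBits-toBits (suc a) exponent exponent<2^[1+a])))))
    generates
  size≤ : size G ≤ (4 + a) * (4 * ⌈log₂ (4 + a) ⌉ + 8) + (ℓ + ℓ) * (2 + ⌈log₂ σ ⌉)
  size≤ = ≤-trans size-bound (+-mono-≤
    (≤-reflexive (cong (λ m → (3 + m) * (4 * ⌈log₂ (3 + m) ⌉ + 8)) (length-toBits (suc a) exponent)))
    (*-monoˡ-≤ (2 + ⌈log₂ σ ⌉) (+-mono-≤ length-root≤ length-remainder≤)))

combine-bounds : ∀ X ℓ′ c P Q → X ≤ 100 * (P + 1) → ℓ′ * c ≤ 3 * Q + 2 →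
                 X + (ℓ′ + ℓ′) * c ≤ 200 * (Q + P + 1)
combine-bounds X ℓ′ c P Q X≤ ℓ′c≤ = begin
    X + (ℓ′ + ℓ′) * c                               ≡⟨ cong (X +_) (*-distribʳ-+ c ℓ′ ℓ′) ⟩
    X + (ℓ′ * c + ℓ′ * c)                           ≤⟨ +-mono-≤ X≤ (+-mono-≤ ℓ′c≤ ℓ′c≤) ⟩
    100 * (P + 1) + ((3 * Q + 2) + (3 * Q + 2))     ≤⟨ m≤m+n _ (194 * Q + 100 * P + 96) ⟩
    100 * (P + 1) + ((3 * Q + 2) + (3 * Q + 2)) + (194 * Q + 100 * P + 96)  ≡⟨ regroup P Q ⟩
    200 * (Q + P + 1)                               ∎
  where
  open ≤-Reasoning
  regroup : ∀ P Q → 100 * (P + 1) + ((3 * Q + 2) + (3 * Q + 2)) + (194 * Q + 100 * P + 96) ≡ 200 * (Q + P + 1)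
  regroup = solve-∀

lemma1 : Σ ℕ λ C → (σ n ℓ : ℕ) → 1 ≤ ℓ → (s : Vec (Fin σ) n) → HasPeriod s ℓ →
           Σ (Grammar σ) λ G → GeneratesExactly G (toList s) ×
             size G ≤ C * (ℓ * ⌈log₂ σ ⌉ + ⌈log₂ n ⌉ * ⌈log₂ ⌈log₂ n ⌉ ⌉ + 1)
lemma1 = 200 , λ σ n ℓ 1≤ℓ s per →
  let ℓ′ , 1≤ℓ′ , per′ , ℓ′-cost = effective-period ℓ s 1≤ℓ per
      G , generates , size≤     = periodic-grammar s 1≤ℓ′ per′
  in G , generates , ≤-trans size≤
       (combine-bounds _ ℓ′ (2 + ⌈log₂ σ ⌉) (⌈log₂ n ⌉ * ⌈log₂ ⌈log₂ n ⌉ ⌉) (ℓ * ⌈log₂ σ ⌉)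
                       (loglog-bound ⌈log₂ n ⌉) ℓ′-cost)
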